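{- Let $k\geq 1$, $n=8k+9$, and $G=C(n,\pm\{1,2,3,4\})$. Then $\dim(G)\leq 6$.
   Context: $C(n,\pm\{1,2,3,4\})$ is the graph on $\mathbb{Z}_n$ where distinct $i,j$ are adjacent iff $j-i\equiv\pm s\pmod n$ for some $s\in\{1,2,3,4\}$. The metric dimension $\dim(G)$ is the minimum size of a set $X$ of vertices such that for any two distinct vertices $u,v$ some $x\in X$ has $d(x,u)\neq d(x,v)$. -}

module Defs where

open import Data.Nat using (ℕ; zero; suc; _+_; _*_; _≤_; NonZero)
open import Data.Nat.DivMod using (_%_)
open import Data.Fin using (Fin; toℕ)
open import Data.List using (List; length)
open import Data.List.Membership.Propositional using (_∈_)
open import Data.Product using (Σ; ∃; _×_; _,_)
open import Data.Sum using (_⊎_)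
open import Relation.Binary.PropositionalEquality using (_≡_; _≢_)

-- The circulant graph C(n, ±{1,2,3,4}) on ℤ_n (vertices Fin n):
-- distinct i, j are adjacent iff j - i ≡ ±s (mod n) for some s ∈ {1,2,3,4}.
-- "j - i ≡ s" is written j ≡ i + s (mod n); "j - i ≡ -s" is i ≡ j + s (mod n).
data Gen : ℕ → Set where
  g1 : Gen 1
  g2 : Gen 2
  g3 : Gen 3
  g4 : Gen 4

Adj : (n : ℕ) → .{{_ : NonZero n}} → Fin n → Fin n → Set
Adj n i j =
  i ≢ j ×
  (∃ λ s → Gen s ×
     ((toℕ j ≡ (toℕ i + s) % n) ⊎ (toℕ i ≡ (toℕ j + s) % n)))

data Walk (n : ℕ) .{{_ : NonZero n}} : Fin n → Fin n → ℕ → Set where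
  here : ∀ {u} → Walk n u u zero
  step : ∀ {u v w m} → Adj n u v → Walk n v w m → Walk n u w (suc m)

Dist : (n : ℕ) → .{{_ : NonZero n}} → Fin n → Fin n → ℕ → Set
Dist n u v m = Walk n u v m × (∀ m' → Walk n u v m' → m ≤ m')

Resolving : (n : ℕ) → .{{_ : NonZero n}} → List (Fin n) → Set
Resolving n X =
  ∀ (u v : Fin n) → u ≢ v →
  ∃ λ x → x ∈ X × ∃ λ a → ∃ λ b → Dist n x u a × Dist n x v b × a ≢ b

DimLe : (n : ℕ) → .{{_ : NonZero n}} → ℕ → Set
DimLe n d = ∃ λ (X : List (Fin n)) → length X ≤ d × Resolving n X

-- In C(n, ±{1,2,3,4}) the distance from x to v is ⌈c/4⌉, where c = min(o, n − o) is the
-- cyclic distance and o = (v − x) mod n. For n = 8k + 9 the landmark 0 sorts the other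
-- vertices into the layers {±(4t + i) : 1 ≤ i ≤ 4} at distance t + 1 (t ≤ k), so it remains
-- to separate the eight vertices of one layer by the landmarks 1, 4, 7, 4k + 6 and 4k + 7.
-- Three families cover all layers: t = 0, 1 ≤ t < k and t = k. In each of them k, t, the
-- layer and the landmarks are affine in two parameters p, q, and so is every distance between
-- them: it is computed once symbolically, comparisons of coefficients deciding each case
-- split. The eight distance vectors then differ in the constant term of some coordinate,
-- which separates the vertices for all p and q at once, hence for every k ≥ 1.

module Submission where

open import Defs
open import Data.Bool using (T)
open import Data.Empty using (⊥; ⊥-elim)
open import Data.Fin using (Fin; toℕ; fromℕ<)
open import Data.Fin.Properties using (toℕ-injective; toℕ<n; toℕ-fromℕ<)
open import Data.List using (List; []; _∷_; map; _++_; length)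
open import Data.List.Properties using (map-++; map-∘; map-cong; map-cong-local)
open import Data.List.Membership.Propositional using (_∈_; find)
open import Data.List.Membership.Propositional.Properties using (∈-map⁺; ∈-map⁻; ∈-++⁺ˡ; ∈-++⁺ʳ; ∈-++⁻)
open import Data.List.Relation.Unary.All as All using (All; []; _∷_; all?)
open import Data.List.Relation.Unary.All.Properties using (map⁺; ¬All⇒Any¬)
open import Data.List.Relation.Unary.AllPairs using (AllPairs; _∷_; allPairs?)
open import Data.List.Relation.Unary.Any using (Any; here; there; any?)
open import Data.Maybe using (Maybe; just; nothing; _>>=_)
open import Data.Nat using (ℕ; zero; suc; _+_; _*_; _∸_; _≤_; _<_; _≤?_; _≤ᵇ_; _⊓_; z≤n; s≤s; NonZero)
open import Data.Nat.DivMod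
open import Data.Nat.Divisibility using (_∣?_; divides-refl)
open import Data.Nat.Properties
open import Data.Nat.Tactic.RingSolver using (solve-∀)
open import Data.Product using (Σ; ∃; _×_; _,_; proj₁; proj₂)
open import Data.Sum using (_⊎_; inj₁; inj₂)
open import Function using (_∘_)
open import Relation.Binary.PropositionalEquality
open import Relation.Nullary using (Dec; yes; no; ¬_)
open import Relation.Nullary.Decidable using (True; toWitness; _×-dec_; ¬?)

⌈_/4⌉ : ℕ → ℕ
⌈ 0 /4⌉ = 0
⌈ 1 /4⌉ = 1
⌈ 2 /4⌉ = 1
⌈ 3 /4⌉ = 1
⌈ suc (suc (suc (suc m))) /4⌉ = suc ⌈ m /4⌉

⌈/4⌉-mono-≤ : ∀ {a b} → a ≤ b → ⌈ a /4⌉ ≤ ⌈ b /4⌉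
⌈/4⌉-mono-≤ {0} _ = z≤n
⌈/4⌉-mono-≤ {1} {1} _ = ≤-refl
⌈/4⌉-mono-≤ {1} {2} _ = ≤-refl
⌈/4⌉-mono-≤ {1} {3} _ = ≤-refl
⌈/4⌉-mono-≤ {1} {suc (suc (suc (suc b)))} _ = s≤s z≤n
⌈/4⌉-mono-≤ {2} {suc b} (s≤s 1≤b) = ⌈/4⌉-mono-≤ {1} (s≤s z≤n)
⌈/4⌉-mono-≤ {3} {suc (suc b)} (s≤s (s≤s 1≤b)) = ⌈/4⌉-mono-≤ {1} (s≤s z≤n)
⌈/4⌉-mono-≤ {suc (suc (suc (suc a)))} (s≤s (s≤s (s≤s (s≤s a≤b)))) = s≤s (⌈/4⌉-mono-≤ a≤b)

⌈m*4+c/4⌉ : ∀ m c → ⌈ m * 4 + c /4⌉ ≡ ⌈ c /4⌉ + m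
⌈m*4+c/4⌉ zero c = sym (+-identityʳ ⌈ c /4⌉)
⌈m*4+c/4⌉ (suc m) c = trans (cong suc (⌈m*4+c/4⌉ m c)) (sym (+-suc ⌈ c /4⌉ m))

module _ (n : ℕ) .{{_ : NonZero n}} where

  [m%n+o]%n≡[m+o]%n : ∀ m o → (m % n + o) % n ≡ (m + o) % n
  [m%n+o]%n≡[m+o]%n m o = begin
    (m % n + o) % n          ≡⟨ %-distribˡ-+ (m % n) o n ⟩
    (m % n % n + o % n) % n  ≡⟨ cong (λ z → (z + o % n) % n) (m%n%n≡m%n m n) ⟩
    (m % n + o % n) % n      ≡⟨ %-distribˡ-+ m o n ⟨
    (m + o) % n              ∎
    where open ≡-Reasoning

  [m+o%n]%n≡[m+o]%n : ∀ m o → (m + o % n) % n ≡ (m + o) % n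
  [m+o%n]%n≡[m+o]%n m o = begin
    (m + o % n) % n  ≡⟨ cong (_% n) (+-comm m (o % n)) ⟩
    (o % n + m) % n  ≡⟨ [m%n+o]%n≡[m+o]%n o m ⟩
    (o + m) % n      ≡⟨ cong (_% n) (+-comm o m) ⟩
    (m + o) % n      ∎
    where open ≡-Reasoning

  %-cancelʳ-+ : ∀ a b {x} → x ≤ n → (a + x) % n ≡ (b + x) % n → a % n ≡ b % n
  %-cancelʳ-+ a b {x} x≤n eq = begin
    a % n                        ≡⟨ [m+n]%n≡m%n a n ⟨
    (a + n) % n                  ≡⟨ shift a ⟩
    ((a + x) % n + (n ∸ x)) % n  ≡⟨ cong (λ z → (z + (n ∸ x)) % n) eq ⟩
    ((b + x) % n + (n ∸ x)) % n  ≡⟨ shift b ⟨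
    (b + n) % n                  ≡⟨ [m+n]%n≡m%n b n ⟩
    b % n                        ∎
    where
    open ≡-Reasoning
    shift : ∀ c → (c + n) % n ≡ ((c + x) % n + (n ∸ x)) % n
    shift c = begin
      (c + n) % n              ≡⟨ cong (λ z → (c + z) % n) (m+[n∸m]≡n x≤n) ⟨
      (c + (x + (n ∸ x))) % n  ≡⟨ cong (_% n) (+-assoc c x (n ∸ x)) ⟨
      (c + x + (n ∸ x)) % n    ≡⟨ [m%n+o]%n≡[m+o]%n (c + x) (n ∸ x) ⟨
      ((c + x) % n + (n ∸ x)) % n ∎

  [m+s]%n-cases : ∀ {m s} → m < n → s ≤ n →
                  (m + s) % n ≡ m + s ⊎ (m + s) % n + n ≡ m + s
  [m+s]%n-cases {m} {s} m<n s≤n with m + s <? n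
  ... | yes m+s<n = inj₁ (m<n⇒m%n≡m m+s<n)
  ... | no m+s≮n = inj₂ (begin
    (m + s) % n + n      ≡⟨ cong (_+ n) (m≤n⇒[n∸m]%m≡n%m n≤m+s) ⟨
    (m + s ∸ n) % n + n  ≡⟨ cong (_+ n) (m<n⇒m%n≡m m+s∸n<n) ⟩
    m + s ∸ n + n        ≡⟨ m∸n+n≡m n≤m+s ⟩
    m + s                ∎)
    where
    open ≡-Reasoning
    n≤m+s : n ≤ m + s
    n≤m+s = ≮⇒≥ m+s≮n
    m+s∸n<n : m + s ∸ n < n
    m+s∸n<n = subst (m + s ∸ n <_) (m+n∸n≡m n n) (∸-monoˡ-< (+-mono-<-≤ m<n s≤n) n≤m+s)

m∸n≤m∸[n+o]+o : ∀ m n o → m ∸ n ≤ m ∸ (n + o) + o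
m∸n≤m∸[n+o]+o m n o = m≤n+o⇒m∸n≤o m n (begin
  m                          ≤⟨ m≤n+m∸n m (n + o) ⟩
  n + o + (m ∸ (n + o))      ≡⟨ +-assoc n o _ ⟩
  n + (o + (m ∸ (n + o)))    ≡⟨ cong (n +_) (+-comm o _) ⟩
  n + (m ∸ (n + o) + o)      ∎)
  where open ≤-Reasoning

cycNorm : ℕ → ℕ → ℕ
cycNorm n o = o ⊓ (n ∸ o)

cycNorm≤ : ∀ n o {c} → o ≤ c ⊎ n ∸ o ≤ c → cycNorm n o ≤ c
cycNorm≤ n o (inj₁ o≤c) = ≤-trans (m⊓n≤m o (n ∸ o)) o≤c
cycNorm≤ n o (inj₂ n∸o≤c) = ≤-trans (m⊓n≤n o (n ∸ o)) n∸o≤c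

cycNorm-step : ∀ n {o′ s o} → o′ < n → o ≡ o′ + s ⊎ o + n ≡ o′ + s →
               cycNorm n o ≤ cycNorm n o′ + s × cycNorm n o′ ≤ cycNorm n o + s
cycNorm-step n {o′} {s} {o} _ (inj₁ refl) = forward (⊓-sel o′ (n ∸ o′)) , backward (⊓-sel o (n ∸ o))
  where
  forward : cycNorm n o′ ≡ o′ ⊎ cycNorm n o′ ≡ n ∸ o′ → cycNorm n o ≤ cycNorm n o′ + s
  forward (inj₁ eq) rewrite eq = cycNorm≤ n o (inj₁ ≤-refl)
  forward (inj₂ eq) rewrite eq =
    cycNorm≤ n o (inj₂ (≤-trans (∸-monoʳ-≤ n (m≤m+n o′ s)) (m≤m+n (n ∸ o′) s)))
  backward : cycNorm n o ≡ o ⊎ cycNorm n o ≡ n ∸ o → cycNorm n o′ ≤ cycNorm n o + s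
  backward (inj₁ eq) rewrite eq = cycNorm≤ n o′ (inj₁ (≤-trans (m≤m+n o′ s) (m≤m+n o s)))
  backward (inj₂ eq) rewrite eq = cycNorm≤ n o′ (inj₂ (m∸n≤m∸[n+o]+o n o′ s))
cycNorm-step n {o′} {s} {o} o′<n (inj₂ wrap) =
  cycNorm≤ n o (inj₁ (≤-trans o≤s (m≤n+m s _))) ,
  cycNorm≤ n o′ (inj₂ (≤-trans n∸o′≤s (m≤n+m s _)))
  where
  o≤s : o ≤ s
  o≤s = +-cancelʳ-≤ n o s (begin
    o + n   ≡⟨ wrap ⟩
    o′ + s  ≤⟨ +-monoˡ-≤ s (<⇒≤ o′<n) ⟩
    n + s   ≡⟨ +-comm n s ⟩
    s + n   ∎)
    where open ≤-Reasoning
  n∸o′≤s : n ∸ o′ ≤ s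
  n∸o′≤s = m≤n+o⇒m∸n≤o n o′ (≤-trans (m≤n+m n o) (≤-reflexive wrap))

module _ (n : ℕ) .{{_ : NonZero n}} where

  offset : ℕ → ℕ → ℕ
  offset x v = (v + (n ∸ x)) % n

  dist : ℕ → ℕ → ℕ
  dist x v = ⌈ cycNorm n (offset x v) /4⌉

  offset<n : ∀ x v → offset x v < n
  offset<n x v = m%n<n (v + (n ∸ x)) n

  offset-self : ∀ {x} → x ≤ n → offset x x ≡ 0
  offset-self x≤n = trans (cong (_% n) (m+[n∸m]≡n x≤n)) (n%n≡0 n)

  offset-shift : ∀ {x y s} w → x ≤ n → y ≤ n → y ≡ (x + s) % n → (offset y w + s) % n ≡ offset x w
  offset-shift {x} {y} {s} w x≤n y≤n y≡x+s = %-cancelʳ-+ n (offset y w + s) (w + (n ∸ x)) x≤n (begin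
    (offset y w + s + x) % n            ≡⟨ cong (_% n) (+-assoc (offset y w) s x) ⟩
    (offset y w + (s + x)) % n          ≡⟨ [m%n+o]%n≡[m+o]%n n (w + (n ∸ y)) (s + x) ⟩
    (w + (n ∸ y) + (s + x)) % n         ≡⟨ cong (λ z → (w + (n ∸ y) + z) % n) (+-comm s x) ⟩
    (w + (n ∸ y) + (x + s)) % n         ≡⟨ [m+o%n]%n≡[m+o]%n n (w + (n ∸ y)) (x + s) ⟨
    (w + (n ∸ y) + (x + s) % n) % n     ≡⟨ cong (λ z → (w + (n ∸ y) + z) % n) y≡x+s ⟨
    (w + (n ∸ y) + y) % n               ≡⟨ cong (_% n) (+-assoc w (n ∸ y) y) ⟩
    (w + (n ∸ y + y)) % n               ≡⟨ cong (λ z → (w + z) % n) (m∸n+n≡m y≤n) ⟩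
    (w + n) % n                         ≡⟨ cong (λ z → (w + z) % n) (m∸n+n≡m x≤n) ⟨
    (w + (n ∸ x + x)) % n               ≡⟨ cong (_% n) (+-assoc w (n ∸ x) x) ⟨
    (w + (n ∸ x) + x) % n               ∎)
    where open ≡-Reasoning

  cycNorm-offset-shift : ∀ {x y s} w → x ≤ n → y ≤ n → s ≤ n → y ≡ (x + s) % n →
    cycNorm n (offset x w) ≤ cycNorm n (offset y w) + s × cycNorm n (offset y w) ≤ cycNorm n (offset x w) + s
  cycNorm-offset-shift {x} {y} {s} w x≤n y≤n s≤n y≡x+s =
    cycNorm-step n (offset<n y w) (wraps ([m+s]%n-cases n (offset<n y w) s≤n))
    where
    shifted : (offset y w + s) % n ≡ offset x w
    shifted = offset-shift w x≤n y≤n y≡x+s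
    wraps : (offset y w + s) % n ≡ offset y w + s ⊎ (offset y w + s) % n + n ≡ offset y w + s →
            offset x w ≡ offset y w + s ⊎ offset x w + n ≡ offset y w + s
    wraps (inj₁ eq) = inj₁ (trans (sym shifted) eq)
    wraps (inj₂ eq) = inj₂ (trans (cong (_+ n) (sym shifted)) eq)

[m+s]%n≢m : ∀ n .{{_ : NonZero n}} {m s} → m < n → 0 < s → s < n → (m + s) % n ≢ m
[m+s]%n≢m n {m} {suc s} m<n _ s<n loop with [m+s]%n-cases n m<n (<⇒≤ s<n)
... | inj₁ no-wrap = m+1+n≢m m (trans (sym no-wrap) loop)
... | inj₂ wrap = <⇒≢ s<n (sym (+-cancelˡ-≡ m n (suc s) (trans (cong (_+ n) (sym loop)) wrap)))

Gen⇒>0 : ∀ {s} → Gen s → 0 < s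
Gen⇒>0 g1 = s≤s z≤n
Gen⇒>0 g2 = s≤s z≤n
Gen⇒>0 g3 = s≤s z≤n
Gen⇒>0 g4 = s≤s z≤n

Gen⇒≤4 : ∀ {s} → Gen s → s ≤ 4
Gen⇒≤4 g1 = s≤s z≤n
Gen⇒≤4 g2 = s≤s (s≤s z≤n)
Gen⇒≤4 g3 = s≤s (s≤s (s≤s z≤n))
Gen⇒≤4 g4 = ≤-refl

module _ {n : ℕ} .{{_ : NonZero n}} (4≤n : 4 ≤ n) where

  cycNorm-offset-adj : ∀ {u v : Fin n} w → Adj n u v →
    cycNorm n (offset n (toℕ u) w) ≤ cycNorm n (offset n (toℕ v) w) + 4
  cycNorm-offset-adj {u} {v} w (_ , s , g , v≡u+s⊎u≡v+s) =
    ≤-trans (close v≡u+s⊎u≡v+s) (+-monoʳ-≤ _ (Gen⇒≤4 g))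
    where
    s≤n : s ≤ n
    s≤n = ≤-trans (Gen⇒≤4 g) 4≤n
    close : toℕ v ≡ (toℕ u + s) % n ⊎ toℕ u ≡ (toℕ v + s) % n →
            cycNorm n (offset n (toℕ u) w) ≤ cycNorm n (offset n (toℕ v) w) + s
    close (inj₁ eq) = proj₁ (cycNorm-offset-shift n w (<⇒≤ (toℕ<n u)) (<⇒≤ (toℕ<n v)) s≤n eq)
    close (inj₂ eq) = proj₂ (cycNorm-offset-shift n w (<⇒≤ (toℕ<n v)) (<⇒≤ (toℕ<n u)) s≤n eq)

  dist≤walk : ∀ {x v : Fin n} {m} → Walk n x v m → dist n (toℕ x) (toℕ v) ≤ m
  dist≤walk {x} here = ≤-reflexive (cong (λ o → ⌈ cycNorm n o /4⌉) (offset-self n (<⇒≤ (toℕ<n x))))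
  dist≤walk {x} {v} (step {v = y} {m = m} adj walk) = begin
    dist n (toℕ x) (toℕ v)                          ≤⟨ ⌈/4⌉-mono-≤ (cycNorm-offset-adj (toℕ v) adj) ⟩
    ⌈ cycNorm n (offset n (toℕ y) (toℕ v)) + 4 /4⌉  ≡⟨ cong ⌈_/4⌉ (+-comm _ 4) ⟩
    suc (dist n (toℕ y) (toℕ v))                    ≤⟨ s≤s (dist≤walk walk) ⟩
    suc m                                           ∎
    where open ≤-Reasoning

module _ (n : ℕ) .{{_ : NonZero n}} {x : ℕ} (x<n : x < n) where

  +-offset : ∀ {v} → v < n → (x + offset n x v) % n ≡ v
  +-offset {v} v<n = begin
    (x + (v + (n ∸ x)) % n) % n  ≡⟨ [m+o%n]%n≡[m+o]%n n x (v + (n ∸ x)) ⟩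
    (x + (v + (n ∸ x))) % n      ≡⟨ cong (_% n) (+-comm x _) ⟩
    (v + (n ∸ x) + x) % n        ≡⟨ cong (_% n) (+-assoc v (n ∸ x) x) ⟩
    (v + (n ∸ x + x)) % n        ≡⟨ cong (λ z → (v + z) % n) (m∸n+n≡m (<⇒≤ x<n)) ⟩
    (v + n) % n                  ≡⟨ [m+n]%n≡m%n v n ⟩
    v % n                        ≡⟨ m<n⇒m%n≡m v<n ⟩
    v                            ∎
    where open ≡-Reasoning

  +-complement : ∀ {o} → o ≤ n → ((x + o) % n + (n ∸ o)) % n ≡ x
  +-complement {o} o≤n = begin
    ((x + o) % n + (n ∸ o)) % n  ≡⟨ [m%n+o]%n≡[m+o]%n n (x + o) (n ∸ o) ⟩
    (x + o + (n ∸ o)) % n        ≡⟨ cong (_% n) (+-assoc x o (n ∸ o)) ⟩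
    (x + (o + (n ∸ o))) % n      ≡⟨ cong (λ z → (x + z) % n) (m+[n∸m]≡n o≤n) ⟩
    (x + n) % n                  ≡⟨ [m+n]%n≡m%n x n ⟩
    x % n                        ≡⟨ m<n⇒m%n≡m x<n ⟩
    x                            ∎
    where open ≡-Reasoning

adj-sym : ∀ {n} .{{_ : NonZero n}} {u v : Fin n} → Adj n u v → Adj n v u
adj-sym (u≢v , s , g , inj₁ eq) = u≢v ∘ sym , s , g , inj₂ eq
adj-sym (u≢v , s , g , inj₂ eq) = u≢v ∘ sym , s , g , inj₁ eq

walk-reverse : ∀ {n} .{{_ : NonZero n}} {u v : Fin n} {m} → Walk n u v m → Walk n v u m
walk-reverse {n} {m = m} walk = subst (Walk n _ _) (+-identityʳ m) (reverseOnto walk here)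
  where
  reverseOnto : ∀ {a b c l k} → Walk n a b l → Walk n a c k → Walk n b c (l + k)
  reverseOnto here acc = acc
  reverseOnto {c = c} {suc l} {k} (step adj walk) acc =
    subst (Walk n _ c) (+-suc l k) (reverseOnto walk (step (adj-sym adj) acc))

module _ {n : ℕ} .{{_ : NonZero n}} (4<n : 4 < n) where

  adj-forward : ∀ (u w : Fin n) {s} → Gen s → toℕ w ≡ (toℕ u + s) % n → Adj n u w
  adj-forward u w g eq = u≢w , _ , g , inj₁ eq
    where
    u≢w : u ≢ w
    u≢w u≡w = [m+s]%n≢m n (toℕ<n u) (Gen⇒>0 g) (≤-<-trans (Gen⇒≤4 g) 4<n)
                (trans (sym eq) (cong toℕ (sym u≡w)))

  walk-forward : ∀ j (u w : Fin n) → toℕ w ≡ (toℕ u + j) % n → Walk n u w ⌈ j /4⌉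
  walk-forward 0 u w eq = subst (λ z → Walk n u z 0) (toℕ-injective u≡w) here
    where
    u≡w : toℕ u ≡ toℕ w
    u≡w = sym (trans eq (trans (cong (_% n) (+-identityʳ (toℕ u))) (m<n⇒m%n≡m (toℕ<n u))))
  walk-forward 1 u w eq = step (adj-forward u w g1 eq) here
  walk-forward 2 u w eq = step (adj-forward u w g2 eq) here
  walk-forward 3 u w eq = step (adj-forward u w g3 eq) here
  walk-forward (suc (suc (suc (suc j)))) u w eq =
    step (adj-forward u u′ g4 u′≡u+4) (walk-forward j u′ w w≡u′+j)
    where
    u′ : Fin n
    u′ = fromℕ< (m%n<n (toℕ u + 4) n)
    u′≡u+4 : toℕ u′ ≡ (toℕ u + 4) % n
    u′≡u+4 = toℕ-fromℕ< (m%n<n (toℕ u + 4) n)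
    w≡u′+j : toℕ w ≡ (toℕ u′ + j) % n
    w≡u′+j = begin
      toℕ w                   ≡⟨ eq ⟩
      (toℕ u + (4 + j)) % n   ≡⟨ cong (_% n) (+-assoc (toℕ u) 4 j) ⟨
      (toℕ u + 4 + j) % n     ≡⟨ [m%n+o]%n≡[m+o]%n n (toℕ u + 4) j ⟨
      ((toℕ u + 4) % n + j) % n ≡⟨ cong (λ z → (z + j) % n) u′≡u+4 ⟨
      (toℕ u′ + j) % n        ∎
      where open ≡-Reasoning

  dist-walk : ∀ (x v : Fin n) → Walk n x v (dist n (toℕ x) (toℕ v))
  dist-walk x v = realise (⊓-sel o (n ∸ o))
    where
    o : ℕ
    o = offset n (toℕ x) (toℕ v)
    x+o≡v : (toℕ x + o) % n ≡ toℕ v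
    x+o≡v = +-offset n (toℕ<n x) (toℕ<n v)
    v+[n∸o]≡x : (toℕ v + (n ∸ o)) % n ≡ toℕ x
    v+[n∸o]≡x = trans (cong (λ z → (z + (n ∸ o)) % n) (sym x+o≡v))
                      (+-complement n (toℕ<n x) (<⇒≤ (offset<n n (toℕ x) (toℕ v))))
    realise : cycNorm n o ≡ o ⊎ cycNorm n o ≡ n ∸ o → Walk n x v ⌈ cycNorm n o /4⌉
    realise (inj₁ eq) = subst (Walk n x v ∘ ⌈_/4⌉) (sym eq) (walk-forward o x v (sym x+o≡v))
    realise (inj₂ eq) = subst (Walk n x v ∘ ⌈_/4⌉) (sym eq)
                          (walk-reverse (walk-forward (n ∸ o) v x (sym v+[n∸o]≡x)))

  dist-isDist : ∀ (x v : Fin n) → Dist n x v (dist n (toℕ x) (toℕ v))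
  dist-isDist x v = dist-walk x v , λ _ → dist≤walk (<⇒≤ 4<n)

module _ (n : ℕ) .{{_ : NonZero n}} where

  offset-unique : ∀ {x v o} → x ≤ n → o < n → v ≡ o + x ⊎ v + n ≡ o + x → offset n x v ≡ o
  offset-unique {x} {v} {o} x≤n o<n (inj₁ refl) = begin
    (o + x + (n ∸ x)) % n    ≡⟨ cong (_% n) (+-assoc o x (n ∸ x)) ⟩
    (o + (x + (n ∸ x))) % n  ≡⟨ cong (λ z → (o + z) % n) (m+[n∸m]≡n x≤n) ⟩
    (o + n) % n              ≡⟨ [m+n]%n≡m%n o n ⟩
    o % n                    ≡⟨ m<n⇒m%n≡m o<n ⟩
    o                        ∎
    where open ≡-Reasoning
  offset-unique {x} {v} {o} x≤n o<n (inj₂ v+n≡o+x) = begin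
    (v + (n ∸ x)) % n  ≡⟨ cong (_% n) (+-∸-assoc v x≤n) ⟨
    (v + n ∸ x) % n    ≡⟨ cong (λ z → (z ∸ x) % n) v+n≡o+x ⟩
    (o + x ∸ x) % n    ≡⟨ cong (_% n) (m+n∸n≡m o x) ⟩
    o % n              ≡⟨ m<n⇒m%n≡m o<n ⟩
    o                  ∎
    where open ≡-Reasoning

cycNorm-near : ∀ {n o} → o + o ≤ n → cycNorm n o ≡ o
cycNorm-near {n} {o} o+o≤n = m≤n⇒m⊓n≡m (m+n≤o⇒m≤o∸n o o+o≤n)

cycNorm-far : ∀ {n o} → o ≤ n → (n ∸ o) + (n ∸ o) ≤ n → cycNorm n o ≡ n ∸ o
cycNorm-far {n} {o} o≤n e+e≤n = m≥n⇒m⊓n≡n (+-cancelˡ-≤ (n ∸ o) (n ∸ o) o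
  (subst (n ∸ o + (n ∸ o) ≤_) (sym (m∸n+n≡m o≤n)) e+e≤n))

Indistinguishable : (n : ℕ) .{{_ : NonZero n}} → List ℕ → ℕ → ℕ → Set
Indistinguishable n xs u v = All (λ x → dist n x u ≡ dist n x v) xs

ResolvedBy : (n : ℕ) .{{_ : NonZero n}} → List ℕ → List ℕ → Set
ResolvedBy n xs vs = ∀ {u v} → u ∈ vs → v ∈ vs → Indistinguishable n xs u v → u ≡ v

ResolvedBy-cong : ∀ {n n′} .{{_ : NonZero n}} .{{_ : NonZero n′}} {xs xs′ vs vs′} →
  n ≡ n′ → xs ≡ xs′ → vs ≡ vs′ → ResolvedBy n xs vs → ResolvedBy n′ xs′ vs′
ResolvedBy-cong refl refl refl resolved = resolved

record Affine : Set where
  constructor affine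
  field
    const pcoeff qcoeff : ℕ

⟦_⟧ : Affine → ℕ → ℕ → ℕ
⟦ affine c a b ⟧ p q = c + (a * p + b * q)

↑_ : ℕ → Affine
↑ c = affine c 0 0

infixl 6 _⊕_ _⊖_
infixl 7 _⊛_
infix 4 _≤ᵃ_ _≤ᵃ?_

_⊕_ : Affine → Affine → Affine
affine c a b ⊕ affine c′ a′ b′ = affine (c + c′) (a + a′) (b + b′)

-- Truncated in each coefficient: f ⊖ g denotes the difference only when g ≤ᵃ f (⟦⊖⟧).
_⊖_ : Affine → Affine → Affine
affine c a b ⊖ affine c′ a′ b′ = affine (c ∸ c′) (a ∸ a′) (b ∸ b′)

_⊛_ : ℕ → Affine → Affine
k ⊛ affine c a b = affine (k * c) (k * a) (k * b)

_≤ᵃ_ : Affine → Affine → Set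
affine c a b ≤ᵃ affine c′ a′ b′ = c ≤ c′ × a ≤ a′ × b ≤ b′

_≤ᵃ?_ : ∀ f g → Dec (f ≤ᵃ g)
affine c a b ≤ᵃ? affine c′ a′ b′ = c ≤? c′ ×-dec a ≤? a′ ×-dec b ≤? b′

⟦⊕⟧ : ∀ f g p q → ⟦ f ⊕ g ⟧ p q ≡ ⟦ f ⟧ p q + ⟦ g ⟧ p q
⟦⊕⟧ (affine c a b) (affine c′ a′ b′) = identity c a b c′ a′ b′
  where
  identity : ∀ c a b c′ a′ b′ p q →
    c + c′ + ((a + a′) * p + (b + b′) * q) ≡ c + (a * p + b * q) + (c′ + (a′ * p + b′ * q))
  identity = solve-∀

⟦↑⟧ : ∀ c p q → ⟦ ↑ c ⟧ p q ≡ c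
⟦↑⟧ c p q = +-identityʳ c

⟦⊛⟧ : ∀ k f p q → ⟦ k ⊛ f ⟧ p q ≡ k * ⟦ f ⟧ p q
⟦⊛⟧ k (affine c a b) = identity k c a b
  where
  identity : ∀ k c a b p q → k * c + (k * a * p + k * b * q) ≡ k * (c + (a * p + b * q))
  identity = solve-∀

≤ᵃ⇒≤ : ∀ {f g} p q → f ≤ᵃ g → ⟦ f ⟧ p q ≤ ⟦ g ⟧ p q
≤ᵃ⇒≤ {affine _ _ _} {affine _ _ _} p q (c≤c′ , a≤a′ , b≤b′) =
  +-mono-≤ c≤c′ (+-mono-≤ (*-monoˡ-≤ p a≤a′) (*-monoˡ-≤ q b≤b′))

⊖-⊕-cancel : ∀ {f g} → g ≤ᵃ f → f ⊖ g ⊕ g ≡ f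
⊖-⊕-cancel {affine _ _ _} {affine _ _ _} (c′≤c , a′≤a , b′≤b)
  rewrite m∸n+n≡m c′≤c | m∸n+n≡m a′≤a | m∸n+n≡m b′≤b = refl

⟦f⊖g⟧+⟦g⟧≡⟦f⟧ : ∀ {f g} p q → g ≤ᵃ f → ⟦ f ⊖ g ⟧ p q + ⟦ g ⟧ p q ≡ ⟦ f ⟧ p q
⟦f⊖g⟧+⟦g⟧≡⟦f⟧ {f} {g} p q g≤f =
  trans (sym (⟦⊕⟧ (f ⊖ g) g p q)) (cong (λ h → ⟦ h ⟧ p q) (⊖-⊕-cancel g≤f))

⟦⊖⟧ : ∀ {f g} p q → g ≤ᵃ f → ⟦ f ⊖ g ⟧ p q ≡ ⟦ f ⟧ p q ∸ ⟦ g ⟧ p q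
⟦⊖⟧ {f} {g} p q g≤f = sym (trans (cong (_∸ ⟦ g ⟧ p q) (sym (⟦f⊖g⟧+⟦g⟧≡⟦f⟧ p q g≤f)))
                                   (m+n∸n≡m (⟦ f ⊖ g ⟧ p q) (⟦ g ⟧ p q)))

module _ (tn : Affine) where

  OffsetOf : Affine → Affine → Affine → Set
  OffsetOf tx tv to = ∀ p q .{{_ : NonZero (⟦ tn ⟧ p q)}} →
    offset (⟦ tn ⟧ p q) (⟦ tx ⟧ p q) (⟦ tv ⟧ p q) ≡ ⟦ to ⟧ p q

  CycNormOf : Affine → Affine → Set
  CycNormOf to tc = ∀ p q → cycNorm (⟦ tn ⟧ p q) (⟦ to ⟧ p q) ≡ ⟦ tc ⟧ p q

  DistOf : Affine → Affine → Affine → Set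
  DistOf tx tv td = ∀ p q .{{_ : NonZero (⟦ tn ⟧ p q)}} →
    dist (⟦ tn ⟧ p q) (⟦ tx ⟧ p q) (⟦ tv ⟧ p q) ≡ ⟦ td ⟧ p q

⌈/4⌉Of : Affine → Affine → Set
⌈/4⌉Of tc td = ∀ p q → ⌈ ⟦ tc ⟧ p q /4⌉ ≡ ⟦ td ⟧ p q

-- Comparisons of coefficients decide, for all p and q at once, which case of offset, cycNorm
-- and ⌈_/4⌉ applies; nothing means that the symbolic evaluation gives up.
offsetCandidate : ∀ tn tx tv to → tx ≤ᵃ tn →
  (∀ p q → ⟦ tv ⟧ p q ≡ ⟦ to ⟧ p q + ⟦ tx ⟧ p q
          ⊎ ⟦ tv ⟧ p q + ⟦ tn ⟧ p q ≡ ⟦ to ⟧ p q + ⟦ tx ⟧ p q) →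
  Maybe (Σ Affine (OffsetOf tn tx tv))
offsetCandidate tn tx tv to tx≤tn representative with ↑ 1 ⊕ to ≤ᵃ? tn
... | no _ = nothing
... | yes 1+to≤tn = just (to , λ p q → offset-unique (⟦ tn ⟧ p q) (≤ᵃ⇒≤ p q tx≤tn)
                                (subst (_≤ ⟦ tn ⟧ p q) (⟦⊕⟧ (↑ 1) to p q) (≤ᵃ⇒≤ p q 1+to≤tn))
                                (representative p q))

symOffset : ∀ tn tx tv → Maybe (Σ Affine (OffsetOf tn tx tv))
symOffset tn tx tv with tx ≤ᵃ? tn | tx ≤ᵃ? tv | tx ≤ᵃ? tv ⊕ tn
... | no _      | _         | _ = nothing
... | yes tx≤tn | yes tx≤tv | _ =
  offsetCandidate tn tx tv (tv ⊖ tx) tx≤tn λ p q → inj₁ (sym (⟦f⊖g⟧+⟦g⟧≡⟦f⟧ p q tx≤tv))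
... | yes tx≤tn | no _      | yes tx≤tv+tn =
  offsetCandidate tn tx tv (tv ⊕ tn ⊖ tx) tx≤tn λ p q →
    inj₂ (trans (sym (⟦⊕⟧ tv tn p q)) (sym (⟦f⊖g⟧+⟦g⟧≡⟦f⟧ p q tx≤tv+tn)))
... | yes _     | no _      | no _ = nothing

symCycNorm : ∀ tn to → Maybe (Σ Affine (CycNormOf tn to))
symCycNorm tn to with to ⊕ to ≤ᵃ? tn | to ≤ᵃ? tn | tn ⊖ to ⊕ (tn ⊖ to) ≤ᵃ? tn
... | yes near | _ | _ = just (to , λ p q →
  cycNorm-near (subst (_≤ ⟦ tn ⟧ p q) (⟦⊕⟧ to to p q) (≤ᵃ⇒≤ p q near)))
... | no _ | yes to≤tn | yes far = just (tn ⊖ to , λ p q →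
  let n∸o≡ = ⟦⊖⟧ p q to≤tn
      [n∸o]+[n∸o]≡ = trans (⟦⊕⟧ (tn ⊖ to) (tn ⊖ to) p q) (cong₂ _+_ n∸o≡ n∸o≡)
  in trans (cycNorm-far (≤ᵃ⇒≤ p q to≤tn) (subst (_≤ ⟦ tn ⟧ p q) [n∸o]+[n∸o]≡ (≤ᵃ⇒≤ p q far)))
           (sym n∸o≡))
... | no _ | _ | _ = nothing

⌈c+[a*4*p+b*4*q]/4⌉ : ∀ c a b p q → ⌈ c + (a * 4 * p + b * 4 * q) /4⌉ ≡ ⌈ c /4⌉ + (a * p + b * q)
⌈c+[a*4*p+b*4*q]/4⌉ c a b p q = begin
  ⌈ c + (a * 4 * p + b * 4 * q) /4⌉  ≡⟨ cong ⌈_/4⌉ (regroup c a b p q) ⟩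
  ⌈ (a * p + b * q) * 4 + c /4⌉      ≡⟨ ⌈m*4+c/4⌉ (a * p + b * q) c ⟩
  ⌈ c /4⌉ + (a * p + b * q)          ∎
  where
  open ≡-Reasoning
  regroup : ∀ c a b p q → c + (a * 4 * p + b * 4 * q) ≡ (a * p + b * q) * 4 + c
  regroup = solve-∀

sym⌈/4⌉ : ∀ tc → Maybe (Σ Affine (⌈/4⌉Of tc))
sym⌈/4⌉ (affine c a b) with 4 ∣? a | 4 ∣? b
... | yes (divides-refl a′) | yes (divides-refl b′) =
  just (affine ⌈ c /4⌉ a′ b′ , ⌈c+[a*4*p+b*4*q]/4⌉ c a′ b′)
... | _ | _ = nothing

record DistForm (tn tx tv : Affine) : Set where
  constructor _by_
  field
    value : Affine
    value-sound : DistOf tn tx tv value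

symDist : ∀ tn tx tv → Maybe (DistForm tn tx tv)
symDist tn tx tv = do
  to , offset≡ ← symOffset tn tx tv
  tc , cycNorm≡ ← symCycNorm tn to
  td , ceil≡ ← sym⌈/4⌉ tc
  just (td by λ p q → trans (cong (λ o → ⌈ cycNorm (⟦ tn ⟧ p q) o /4⌉) (offset≡ p q))
                           (trans (cong ⌈_/4⌉ (cycNorm≡ p q)) (ceil≡ p q)))

AllPairs-∈ : ∀ {A : Set} {R : A → A → Set} {xs x y} →
  AllPairs R xs → x ∈ xs → y ∈ xs → x ≡ y ⊎ R x y ⊎ R y x
AllPairs-∈ (_ ∷ _) (here refl) (here refl) = inj₁ refl
AllPairs-∈ (Rx ∷ _) (here refl) (there y∈) = inj₂ (inj₁ (All.lookup Rx y∈))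
AllPairs-∈ (Rx ∷ _) (there x∈) (here refl) = inj₂ (inj₂ (All.lookup Rx x∈))
AllPairs-∈ (_ ∷ pairs) (there x∈) (there y∈) = AllPairs-∈ pairs x∈ y∈

module _ {tn tx tv tv′ : Affine} where

  Apart : Maybe (DistForm tn tx tv) → Maybe (DistForm tn tx tv′) → Set
  Apart (just (affine c a b by _)) (just (affine c′ a′ b′ by _)) = c ≢ c′ × a ≡ a′ × b ≡ b′
  Apart _ _ = ⊥

  apart? : ∀ d d′ → Dec (Apart d d′)
  apart? (just (affine c a b by _)) (just (affine c′ a′ b′ by _)) =
    ¬? (c ≟ c′) ×-dec a ≟ a′ ×-dec b ≟ b′
  apart? (just _) nothing = no λ ()
  apart? nothing _ = no λ ()

  Apart⇒dist≢ : ∀ {d d′} → Apart d d′ → ∀ p q .{{_ : NonZero (⟦ tn ⟧ p q)}} →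
    dist (⟦ tn ⟧ p q) (⟦ tx ⟧ p q) (⟦ tv ⟧ p q) ≢ dist (⟦ tn ⟧ p q) (⟦ tx ⟧ p q) (⟦ tv′ ⟧ p q)
  Apart⇒dist≢ {just (affine c a b by dist≡)} {just (affine c′ _ _ by dist′≡)}
              (c≢c′ , refl , refl) p q same =
    c≢c′ (+-cancelʳ-≡ (a * p + b * q) c c′ (trans (sym (dist≡ p q)) (trans same (dist′≡ p q))))

Distinguishes : Affine → List Affine → Affine → Affine → Set
Distinguishes tn xs tv tv′ = Any (λ tx → Apart (symDist tn tx tv) (symDist tn tx tv′)) xs

Separates : Affine → List Affine → List Affine → Set
Separates tn xs = AllPairs (Distinguishes tn xs)

separates? : ∀ tn xs vs → Dec (Separates tn xs vs)
separates? tn xs =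
  allPairs? λ tv tv′ → any? (λ tx → apart? (symDist tn tx tv) (symDist tn tx tv′)) xs

module _ (p q : ℕ) {tn : Affine} .{{_ : NonZero (⟦ tn ⟧ p q)}} where

  Distinguishes⇒¬Indistinguishable : ∀ {xs tv tv′} → Distinguishes tn xs tv tv′ →
    ¬ Indistinguishable (⟦ tn ⟧ p q) (map (λ f → ⟦ f ⟧ p q) xs) (⟦ tv ⟧ p q) (⟦ tv′ ⟧ p q)
  Distinguishes⇒¬Indistinguishable (here apart) (same ∷ _) = Apart⇒dist≢ apart p q same
  Distinguishes⇒¬Indistinguishable (there d) (_ ∷ same) = Distinguishes⇒¬Indistinguishable d same

  separates-sound : ∀ {xs vs} → Separates tn xs vs →
    ResolvedBy (⟦ tn ⟧ p q) (map (λ f → ⟦ f ⟧ p q) xs) (map (λ f → ⟦ f ⟧ p q) vs)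
  separates-sound separated u∈ v∈ same
    with ∈-map⁻ (λ f → ⟦ f ⟧ p q) u∈ | ∈-map⁻ (λ f → ⟦ f ⟧ p q) v∈
  ... | tv , tv∈ , refl | tv′ , tv′∈ , refl with AllPairs-∈ separated tv∈ tv′∈
  ... | inj₁ refl = refl
  ... | inj₂ (inj₁ d) = ⊥-elim (Distinguishes⇒¬Indistinguishable d same)
  ... | inj₂ (inj₂ d) = ⊥-elim (Distinguishes⇒¬Indistinguishable d (All.map sym same))

landmarks : ℕ → List ℕ
landmarks k = 0 ∷ 1 ∷ 4 ∷ 7 ∷ 6 + 4 * k ∷ 7 + 4 * k ∷ []

quarter : ℕ → List ℕ
quarter t = map (t * 4 +_) (1 ∷ 2 ∷ 3 ∷ 4 ∷ [])

layer : ℕ → ℕ → List ℕ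
layer n t = quarter t ++ map (n ∸_) (quarter t)

∈-quarter⇒⌈/4⌉ : ∀ {m t} → m ∈ quarter t → ⌈ m /4⌉ ≡ suc t
∈-quarter⇒⌈/4⌉ {t = t} (here refl) = ⌈m*4+c/4⌉ t 1
∈-quarter⇒⌈/4⌉ {t = t} (there (here refl)) = ⌈m*4+c/4⌉ t 2
∈-quarter⇒⌈/4⌉ {t = t} (there (there (here refl))) = ⌈m*4+c/4⌉ t 3
∈-quarter⇒⌈/4⌉ {t = t} (there (there (there (here refl)))) = ⌈m*4+c/4⌉ t 4

∈-quarter⇒bounds : ∀ {m t} → m ∈ quarter t → 0 < m × m ≤ t * 4 + 4
∈-quarter⇒bounds {t = t} m∈ with ∈-map⁻ (t * 4 +_) m∈
... | i , i∈ , refl = ≤-trans (digit-bounds i∈ .proj₁) (m≤n+m i (t * 4)) ,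
                      +-monoʳ-≤ (t * 4) (digit-bounds i∈ .proj₂)
  where
  digit-bounds : ∀ {i} → i ∈ 1 ∷ 2 ∷ 3 ∷ 4 ∷ [] → 0 < i × i ≤ 4
  digit-bounds (here refl) = s≤s z≤n , s≤s z≤n
  digit-bounds (there (here refl)) = s≤s z≤n , s≤s (s≤s z≤n)
  digit-bounds (there (there (here refl))) = s≤s z≤n , s≤s (s≤s (s≤s z≤n))
  digit-bounds (there (there (there (here refl)))) = s≤s z≤n , ≤-refl

∈-quarter : ∀ {m} → 0 < m → ∃ λ t → m ∈ quarter t × t * 4 < m
∈-quarter {1} _ = 0 , here refl , s≤s z≤n
∈-quarter {2} _ = 0 , there (here refl) , s≤s z≤n
∈-quarter {3} _ = 0 , there (there (here refl)) , s≤s z≤n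
∈-quarter {4} _ = 0 , there (there (there (here refl))) , s≤s z≤n
∈-quarter {suc (suc (suc (suc (suc m))))} _ with ∈-quarter {suc m} (s≤s z≤n)
... | t , m∈ , t*4<m = suc t , ∈-map⁺ (4 +_) m∈ , s≤s (s≤s (s≤s (s≤s t*4<m)))

module _ (n : ℕ) .{{_ : NonZero n}} where

  offset-from-0 : ∀ {u} → u < n → offset n 0 u ≡ u
  offset-from-0 {u} u<n = trans ([m+n]%n≡m%n u n) (m<n⇒m%n≡m u<n)

  dist-from-0 : ∀ {u} → u < n → dist n 0 u ≡ ⌈ cycNorm n u /4⌉
  dist-from-0 u<n = cong (λ o → ⌈ cycNorm n o /4⌉) (offset-from-0 u<n)

cycNorm-flip : ∀ {n m} → m ≤ n → cycNorm n (n ∸ m) ≡ cycNorm n m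
cycNorm-flip {n} {m} m≤n = trans (cong ((n ∸ m) ⊓_) (m∸[m∸n]≡n m≤n)) (⊓-comm (n ∸ m) m)

≤-quarter-index : ∀ {t k m} → t * 4 < m → m ≤ k * 4 + 4 → t ≤ k
≤-quarter-index {t} {k} t*4<m m≤k*4+4 =
  ≤-pred (*-cancelʳ-< 4 t (suc k) (<-≤-trans t*4<m (≤-trans m≤k*4+4 (≤-reflexive (+-comm (k * 4) 4)))))

module _ {k : ℕ} where

  private
    n : ℕ
    n = 9 + 8 * k

  vertex-layer : ∀ {u} → u < n → u ≡ 0 ⊎ ∃ λ t → t ≤ k × u ∈ layer n t
  vertex-layer {zero} _ = inj₁ refl
  vertex-layer {u@(suc _)} u<n with u ≤? k * 4 + 4
  ... | yes u≤k*4+4 with ∈-quarter {u} (s≤s z≤n)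
  ...   | t , u∈ , t*4<u = inj₂ (t , ≤-quarter-index t*4<u u≤k*4+4 , ∈-++⁺ˡ u∈)
  vertex-layer {u} u<n | no u≰k*4+4 with ∈-quarter (m<n⇒0<n∸m u<n)
  ...   | t , n∸u∈ , t*4<n∸u =
    inj₂ (t , ≤-quarter-index t*4<n∸u n∸u≤k*4+4 ,
          subst (_∈ layer n t) (m∸[m∸n]≡n (<⇒≤ u<n)) (∈-++⁺ʳ (quarter t) (∈-map⁺ (n ∸_) n∸u∈)))
    where
    n∸u≤k*4+4 : n ∸ u ≤ k * 4 + 4
    n∸u≤k*4+4 = begin
      n ∸ u                          ≤⟨ ∸-monoʳ-≤ n (≰⇒> u≰k*4+4) ⟩
      n ∸ suc (k * 4 + 4)            ≡⟨ cong (_∸ suc (k * 4 + 4)) (split k) ⟩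
      suc (k * 4 + 4) + (k * 4 + 4) ∸ suc (k * 4 + 4) ≡⟨ m+n∸m≡n (suc (k * 4 + 4)) (k * 4 + 4) ⟩
      k * 4 + 4                      ∎
      where
      open ≤-Reasoning
      split : ∀ k → 9 + 8 * k ≡ suc (k * 4 + 4) + (k * 4 + 4)
      split = solve-∀

  ∈-quarter⇒m+m≤n : ∀ {t m} → t ≤ k → m ∈ quarter t → m + m ≤ n
  ∈-quarter⇒m+m≤n {t} {m} t≤k m∈ = begin
    m + m                        ≤⟨ +-mono-≤ m≤k*4+4 m≤k*4+4 ⟩
    (k * 4 + 4) + (k * 4 + 4)    ≤⟨ n≤1+n _ ⟩
    suc ((k * 4 + 4) + (k * 4 + 4)) ≡⟨ double k ⟩
    n                            ∎
    where
    open ≤-Reasoning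
    m≤k*4+4 : m ≤ k * 4 + 4
    m≤k*4+4 = ≤-trans (∈-quarter⇒bounds {t = t} m∈ .proj₂) (+-monoˡ-≤ 4 (*-monoˡ-≤ 4 t≤k))
    double : ∀ k → suc ((k * 4 + 4) + (k * 4 + 4)) ≡ 9 + 8 * k
    double = solve-∀

  ⌈cycNorm/4⌉-quarter : ∀ {t m} → t ≤ k → m ∈ quarter t → ⌈ cycNorm n m /4⌉ ≡ suc t
  ⌈cycNorm/4⌉-quarter t≤k m∈ =
    trans (cong ⌈_/4⌉ (cycNorm-near (∈-quarter⇒m+m≤n t≤k m∈))) (∈-quarter⇒⌈/4⌉ m∈)

  ∈-layer⇒dist-from-0 : ∀ {t u} → t ≤ k → u ∈ layer n t → dist n 0 u ≡ suc t
  ∈-layer⇒dist-from-0 {t} {u} t≤k u∈ with ∈-++⁻ (quarter t) u∈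
  ... | inj₁ u∈q = trans (dist-from-0 n u<n) (⌈cycNorm/4⌉-quarter t≤k u∈q)
    where
    u<n : u < n
    u<n = <-≤-trans (m<m+n u (∈-quarter⇒bounds {t = t} u∈q .proj₁)) (∈-quarter⇒m+m≤n {t} t≤k u∈q)
  ... | inj₂ u∈n∸q with ∈-map⁻ (n ∸_) {xs = quarter t} u∈n∸q
  ...   | m , m∈q , refl = begin
    dist n 0 (n ∸ m)        ≡⟨ dist-from-0 n n∸m<n ⟩
    ⌈ cycNorm n (n ∸ m) /4⌉ ≡⟨ cong ⌈_/4⌉ (cycNorm-flip m≤n) ⟩
    ⌈ cycNorm n m /4⌉       ≡⟨ ⌈cycNorm/4⌉-quarter {t} t≤k m∈q ⟩
    suc t                   ∎
    where
    open ≡-Reasoning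
    m≤n : m ≤ n
    m≤n = ≤-trans (m≤m+n m m) (∈-quarter⇒m+m≤n {t} t≤k m∈q)
    n∸m<n : n ∸ m < n
    n∸m<n = ∸-monoʳ-< (∈-quarter⇒bounds {t = t} m∈q .proj₁) m≤n

modulusᵃ : Affine → Affine
modulusᵃ k = ↑ 9 ⊕ 8 ⊛ k

landmarksᵃ : Affine → List Affine
landmarksᵃ k = ↑ 0 ∷ ↑ 1 ∷ ↑ 4 ∷ ↑ 7 ∷ ↑ 6 ⊕ 4 ⊛ k ∷ ↑ 7 ⊕ 4 ⊛ k ∷ []

quarterᵃ : Affine → List Affine
quarterᵃ t = map (λ i → 4 ⊛ t ⊕ ↑ i) (1 ∷ 2 ∷ 3 ∷ 4 ∷ [])

layerᵃ : Affine → Affine → List Affine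
layerᵃ tn t = quarterᵃ t ++ map (tn ⊖_) (quarterᵃ t)

module _ (p q : ℕ) where

  private
    ⟦_⟧′ : Affine → ℕ
    ⟦ f ⟧′ = ⟦ f ⟧ p q

  ⟦modulusᵃ⟧ : ∀ k → ⟦ modulusᵃ k ⟧′ ≡ 9 + 8 * ⟦ k ⟧′
  ⟦modulusᵃ⟧ k = trans (⟦⊕⟧ (↑ 9) (8 ⊛ k) p q) (cong (9 +_) (⟦⊛⟧ 8 k p q))

  ⟦landmarksᵃ⟧ : ∀ k → map ⟦_⟧′ (landmarksᵃ k) ≡ landmarks ⟦ k ⟧′
  ⟦landmarksᵃ⟧ k =
    cong (λ xs → 0 ∷ 1 ∷ 4 ∷ 7 ∷ xs) (cong₂ _∷_ (shifted 6) (cong (_∷ []) (shifted 7)))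
    where
    shifted : ∀ c → ⟦ ↑ c ⊕ 4 ⊛ k ⟧′ ≡ c + 4 * ⟦ k ⟧′
    shifted c = trans (⟦⊕⟧ (↑ c) (4 ⊛ k) p q) (cong₂ _+_ (⟦↑⟧ c p q) (⟦⊛⟧ 4 k p q))

  ⟦quarterᵃ⟧ : ∀ t → map ⟦_⟧′ (quarterᵃ t) ≡ quarter ⟦ t ⟧′
  ⟦quarterᵃ⟧ t = trans (sym (map-∘ {g = ⟦_⟧′} {f = λ i → 4 ⊛ t ⊕ ↑ i} digits)) (map-cong element digits)
    where
    digits : List ℕ
    digits = 1 ∷ 2 ∷ 3 ∷ 4 ∷ []
    element : ∀ i → ⟦ 4 ⊛ t ⊕ ↑ i ⟧′ ≡ ⟦ t ⟧′ * 4 + i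
    element i = trans (⟦⊕⟧ (4 ⊛ t) (↑ i) p q)
                      (cong₂ _+_ (trans (⟦⊛⟧ 4 t p q) (*-comm 4 ⟦ t ⟧′)) (⟦↑⟧ i p q))

  ⟦layerᵃ⟧ : ∀ tn t → All (_≤ᵃ tn) (quarterᵃ t) →
    map ⟦_⟧′ (layerᵃ tn t) ≡ layer ⟦ tn ⟧′ ⟦ t ⟧′
  ⟦layerᵃ⟧ tn t fits = begin
    map ⟦_⟧′ (quarterᵃ t ++ mirror)             ≡⟨ map-++ ⟦_⟧′ (quarterᵃ t) mirror ⟩
    map ⟦_⟧′ (quarterᵃ t) ++ map ⟦_⟧′ mirror    ≡⟨ cong₂ _++_ (⟦quarterᵃ⟧ t) ⟦mirror⟧ ⟩
    quarter ⟦ t ⟧′ ++ map (⟦ tn ⟧′ ∸_) (quarter ⟦ t ⟧′) ∎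
    where
    open ≡-Reasoning
    mirror : List Affine
    mirror = map (tn ⊖_) (quarterᵃ t)
    ⟦mirror⟧ : map ⟦_⟧′ mirror ≡ map (⟦ tn ⟧′ ∸_) (quarter ⟦ t ⟧′)
    ⟦mirror⟧ = begin
      map ⟦_⟧′ (map (tn ⊖_) (quarterᵃ t))
        ≡⟨ map-∘ {g = ⟦_⟧′} {f = tn ⊖_} (quarterᵃ t) ⟨
      map (λ f → ⟦ tn ⊖ f ⟧′) (quarterᵃ t)
        ≡⟨ map-cong-local (All.map (λ {g} → ⟦⊖⟧ {tn} {g} p q) fits) ⟩
      map (λ f → ⟦ tn ⟧′ ∸ ⟦ f ⟧′) (quarterᵃ t)
        ≡⟨ map-∘ {g = ⟦ tn ⟧′ ∸_} {f = ⟦_⟧′} (quarterᵃ t) ⟩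
      map (⟦ tn ⟧′ ∸_) (map ⟦_⟧′ (quarterᵃ t))
        ≡⟨ cong (map (⟦ tn ⟧′ ∸_)) (⟦quarterᵃ⟧ t) ⟩
      map (⟦ tn ⟧′ ∸_) (quarter ⟦ t ⟧′)
        ∎

⟦c+p⟧ : ∀ c p q → ⟦ affine c 1 0 ⟧ p q ≡ c + p
⟦c+p⟧ c p q = cong (c +_) (trans (+-identityʳ (1 * p)) (*-identityˡ p))

⟦c+p+q⟧ : ∀ c p q → ⟦ affine c 1 1 ⟧ p q ≡ c + p + q
⟦c+p+q⟧ c p q = trans (cong (λ z → c + (z + 1 * q)) (*-identityˡ p))
                   (trans (cong (λ z → c + (p + z)) (*-identityˡ q)) (sym (+-assoc c p q)))

LayerResolved : ℕ → ℕ → Set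
LayerResolved k t = ResolvedBy (9 + 8 * k) (landmarks k) (layer (9 + 8 * k) t)

-- For closed forms k and t the implicit arguments are found by evaluating the decisions.
LayerResolved-affine : ∀ k t
  {fits : True (all? (_≤ᵃ? modulusᵃ k) (quarterᵃ t))}
  {separated : True (separates? (modulusᵃ k) (landmarksᵃ k) (layerᵃ (modulusᵃ k) t))} →
  ∀ p q → LayerResolved (⟦ k ⟧ p q) (⟦ t ⟧ p q)
LayerResolved-affine k t {fits} {separated} p q =
  ResolvedBy-cong (⟦modulusᵃ⟧ p q k) (⟦landmarksᵃ⟧ p q k)
    (trans (⟦layerᵃ⟧ p q (modulusᵃ k) t (toWitness fits))
           (cong (λ n → layer n (⟦ t ⟧ p q)) (⟦modulusᵃ⟧ p q k)))
    (separates-sound p q (toWitness separated))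

layerResolved : ∀ {k t} → 1 ≤ k → t ≤ k → LayerResolved k t
layerResolved {suc k} {zero} _ _ =
  subst₂ LayerResolved (⟦c+p⟧ 1 k 0) (refl {x = 0}) (LayerResolved-affine (affine 1 1 0) (↑ 0) k 0)
layerResolved {k} {suc t} _ 1+t≤k with suc t ≟ k
... | yes refl = subst₂ LayerResolved (⟦c+p⟧ 1 t 0) (⟦c+p⟧ 1 t 0)
                   (LayerResolved-affine (affine 1 1 0) (affine 1 1 0) t 0)
... | no 1+t≢k = subst₂ LayerResolved k≡ (⟦c+p⟧ 1 t (k ∸ (2 + t)))
                   (LayerResolved-affine (affine 2 1 1) (affine 1 1 0) t (k ∸ (2 + t)))
  where
  k≡ : ⟦ affine 2 1 1 ⟧ t (k ∸ (2 + t)) ≡ k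
  k≡ = trans (⟦c+p+q⟧ 2 t (k ∸ (2 + t))) (m+[n∸m]≡n (≤∧≢⇒< 1+t≤k 1+t≢k))

landmarks-resolve : ∀ {k} → 1 ≤ k → ∀ {u v} → u < 9 + 8 * k → v < 9 + 8 * k →
  Indistinguishable (9 + 8 * k) (landmarks k) u v → u ≡ v
landmarks-resolve {k} 1≤k {u} {v} u<n v<n same = compare (vertex-layer u<n) (vertex-layer v<n)
  where
  n : ℕ
  n = 9 + 8 * k
  dist-0-0 : dist n 0 0 ≡ 0
  dist-0-0 = dist-from-0 n (s≤s z≤n)
  same-from-0 : dist n 0 u ≡ dist n 0 v
  same-from-0 = All.head same
  compare : u ≡ 0 ⊎ ∃ (λ t → t ≤ k × u ∈ layer n t) →
            v ≡ 0 ⊎ ∃ (λ t → t ≤ k × v ∈ layer n t) → u ≡ v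
  compare (inj₁ refl) (inj₁ refl) = refl
  compare (inj₁ refl) (inj₂ (t , t≤k , v∈)) =
    ⊥-elim (0≢1+n (trans (sym dist-0-0) (trans same-from-0 (∈-layer⇒dist-from-0 t≤k v∈))))
  compare (inj₂ (t , t≤k , u∈)) (inj₁ refl) =
    ⊥-elim (0≢1+n (trans (sym dist-0-0) (trans (sym same-from-0) (∈-layer⇒dist-from-0 t≤k u∈))))
  compare (inj₂ (t , t≤k , u∈)) (inj₂ (t′ , t′≤k , v∈))
    with suc-injective (trans (sym (∈-layer⇒dist-from-0 t≤k u∈))
                              (trans same-from-0 (∈-layer⇒dist-from-0 t′≤k v∈)))
  ... | refl = layerResolved 1≤k t≤k u∈ v∈ same

module _ {n : ℕ} .{{_ : NonZero n}} where

  finList : (xs : List ℕ) → All (_< n) xs → List (Fin n)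
  finList [] [] = []
  finList (x ∷ xs) (x<n ∷ xs<n) = fromℕ< x<n ∷ finList xs xs<n

  map-toℕ-finList : ∀ xs (xs<n : All (_< n) xs) → map toℕ (finList xs xs<n) ≡ xs
  map-toℕ-finList [] [] = refl
  map-toℕ-finList (x ∷ xs) (x<n ∷ xs<n) = cong₂ _∷_ (toℕ-fromℕ< x<n) (map-toℕ-finList xs xs<n)

  length-finList : ∀ xs (xs<n : All (_< n) xs) → length (finList xs xs<n) ≡ length xs
  length-finList [] [] = refl
  length-finList (x ∷ xs) (x<n ∷ xs<n) = cong suc (length-finList xs xs<n)

  dist-agree? : ∀ (u v x : Fin n) → Dec (dist n (toℕ x) (toℕ u) ≡ dist n (toℕ x) (toℕ v))
  dist-agree? u v x = dist n (toℕ x) (toℕ u) ≟ dist n (toℕ x) (toℕ v)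

  resolving-from-injective : 4 < n → (X : List (Fin n)) →
    (∀ u v → Indistinguishable n (map toℕ X) (toℕ u) (toℕ v) → u ≡ v) → Resolving n X
  resolving-from-injective 4<n X injective u v u≢v with all? (dist-agree? u v) X
  ... | yes same = ⊥-elim (u≢v (injective u v (map⁺ same)))
  ... | no differ with find (¬All⇒Any¬ (dist-agree? u v) X differ)
  ...   | x , x∈X , dx≢ = x , x∈X , _ , _ , dist-isDist 4<n x u , dist-isDist 4<n x v , dx≢

landmarks<n : ∀ k → All (_< 9 + 8 * k) (landmarks k)
landmarks<n k = small 0 ∷ small 1 ∷ small 4 ∷ small 7 ∷ shifted 6 ∷ shifted 7 ∷ []
  where
  small : ∀ x {x<9 : T (suc x ≤ᵇ 9)} → x < 9 + 8 * k
  small x {x<9} = ≤-trans (≤ᵇ⇒≤ (suc x) 9 x<9) (m≤m+n 9 (8 * k))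
  shifted : ∀ c {c<9 : T (suc c ≤ᵇ 9)} → c + 4 * k < 9 + 8 * k
  shifted c {c<9} = +-mono-<-≤ (≤ᵇ⇒≤ (suc c) 9 c<9) (*-monoˡ-≤ k (≤ᵇ⇒≤ 4 8 _))

lemma5p1 : (k : ℕ) → 1 ≤ k → DimLe (9 + 8 * k) 6
lemma5p1 k 1≤k = X , ≤-reflexive (length-finList (landmarks k) (landmarks<n k)) ,
                 resolving-from-injective (s≤s (s≤s (s≤s (s≤s (s≤s z≤n))))) X injective
  where
  X : List (Fin (9 + 8 * k))
  X = finList (landmarks k) (landmarks<n k)
  injective : ∀ u v → Indistinguishable (9 + 8 * k) (map toℕ X) (toℕ u) (toℕ v) → u ≡ v
  injective u v same = toℕ-injective (landmarks-resolve 1≤k (toℕ<n u) (toℕ<n v)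
    (subst (λ xs → Indistinguishable (9 + 8 * k) xs (toℕ u) (toℕ v))
           (map-toℕ-finList (landmarks k) (landmarks<n k)) same))
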